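{- Let $m,n\ge1$ be integers and suppose $(\alpha,\beta)$ is a $\left(-\frac nm\right)$-critical pair of compositions in $\mathbb{N}_0^N$. Then $\ell(\beta)\le\ell(\alpha)+|\alpha|$.
   Context: $\mathbb{N}_0=\{0,1,2,\ldots\}$; $|\alpha|=\sum_i\alpha_i$, $\ell(\alpha)=\max\{j:\alpha_j>0\}$. Rank: $r(\alpha,i)=\#\{j:\alpha_j>\alpha_i\}+\#\{j:1\le j\le i,\ \alpha_j=\alpha_i\}$. $\alpha^+$ is the weakly decreasing rearrangement of $\alpha$; $\alpha\succ\beta$ means $\alpha\ne\beta$ and $\sum_{i\le j}\alpha_i\ge\sum_{i\le j}\beta_i$ for all $j$; $\alpha\vartriangleright\beta$ means $|\alpha|=|\beta|$ and either $\alpha^+\succ\beta^+$, or $\alpha^+=\beta^+$ and $\alpha\succ\beta$. $(\alpha,\beta)$ is a $\left(-\frac nm\right)$-critical pair if $\alpha\vartriangleright\beta$ and $m\kappa+n$ divides $(r(\beta,i)-r(\alpha,i))\kappa+\alpha_i-\beta_i$ in $\mathbb{Q}[\kappa]$ for each $i$, equivalently $(r(\beta,i)-r(\alpha,i))n=m(\alpha_i-\beta_i)$ for all $i$. -}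

module Defs where

open import Data.Nat using (ℕ; zero; suc; _+_; _≤_; _<_; _⊔_; _≤ᵇ_; _<ᵇ_; _≡ᵇ_)
open import Data.Bool using (Bool; true; false; if_then_else_; _∧_)
open import Data.Fin using (Fin; toℕ)
open import Data.List using (List; []; _∷_; length; filterᵇ; take; foldr; allFin)
open import Data.Nat.ListAction using (sum)
open import Data.List.Base using () renaming (tabulate to tabulateL)
open import Data.Integer as ℤ using (ℤ; +_)
open import Data.Product using (_×_)
open import Relation.Binary.PropositionalEquality using (_≡_)
open import Relation.Nullary using (¬_)

-- A composition in ℕ₀^N, indexed by Fin N (index i : Fin N stands for position toℕ i + 1).
Comp : ℕ → Set
Comp N = Fin N → ℕ

toL : ∀ {N} → Comp N → List ℕ
toL α = tabulateL α

size : ∀ {N} → Comp N → ℕ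
size α = sum (toL α)

len : ∀ {N} → Comp N → ℕ
len {N} α = foldr (λ i acc → (if 0 <ᵇ α i then suc (toℕ i) else 0) ⊔ acc) 0 (allFin N)

rank : ∀ {N} → Comp N → Fin N → ℕ
rank {N} α i =
  length (filterᵇ (λ j → α i <ᵇ α j) (allFin N))
  + length (filterᵇ (λ j → (toℕ j ≤ᵇ toℕ i) ∧ (α j ≡ᵇ α i)) (allFin N))

insertDec : ℕ → List ℕ → List ℕ
insertDec x [] = x ∷ []
insertDec x (y ∷ ys) = if y ≤ᵇ x then x ∷ y ∷ ys else y ∷ insertDec x ys

sortDec : List ℕ → List ℕ
sortDec = foldr insertDec []

plus : ∀ {N} → Comp N → List ℕ
plus α = sortDec (toL α)

_≻_ : List ℕ → List ℕ → Set
a ≻ b = ¬ (a ≡ b) × (∀ j → sum (take j b) ≤ sum (take j a))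

data _⊳_ {N : ℕ} (α β : Comp N) : Set where
  byPlus : size α ≡ size β → plus α ≻ plus β → α ⊳ β
  bySame : size α ≡ size β → plus α ≡ plus β → toL α ≻ toL β → α ⊳ β

CriticalPair : ∀ {N} → ℕ → ℕ → Comp N → Comp N → Set
CriticalPair {N} n m α β =
  α ⊳ β ×
  (∀ (i : Fin N) →
     (+ rank β i ℤ.- + rank α i) ℤ.* + n ≡ + m ℤ.* (+ α i ℤ.- + β i))

-- Suppose β had a nonzero entry at a position q ≥ ℓ(α) + |α|. Since β has at most |β| = |α|
-- nonzero entries, some position j with ℓ(α) ≤ j < q has β_j = 0, and α_j = 0 as j ≥ ℓ(α).
-- At such a j the critical condition reads (r(β,j) − r(α,j)) n = 0, so r(α,j) = r(β,j).
-- But the rank of a zero entry is #{k : entry > 0} + #{k ≤ j : entry = 0}: for α every nonzero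
-- entry precedes j, so r(α,j) = j, while for β the nonzero entry at q > j adds one more, so r(β,j) > j.

{-# OPTIONS --safe #-}
module Submission where

open import Defs
open import Data.Nat
  using (ℕ; zero; suc; _+_; _≤_; _<_; _⊔_; _⊓_; _≤ᵇ_; _<ᵇ_; _≡ᵇ_; z≤n; s≤s; s≤s⁻¹; _≤?_; _<?_; _≟_)
open import Data.Nat.Properties
  using ( ≤-refl; ≤-reflexive; ≤-trans; <⇒≤; <⇒≢; <⇒≱; ≤∧≢⇒<; ≰⇒>; ≮⇒≥; <-≤-trans; m≤m+n; m≤n⇒m≤o⊔n
        ; m≤m⊔n; ⊔-lub; ⊓-zeroʳ; m⊓n≤m; m≤n⇒m⊓n≡m; +-mono-≤; +-mono-<-≤; +-mono-≤-<; <⇒<ᵇ; n<1+n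
        ; <ᵇ-reflects-<; +-commutativeSemigroup; module ≤-Reasoning)
open import Algebra.Properties.CommutativeSemigroup +-commutativeSemigroup using (interchange)
open import Data.Bool using (Bool; true; false; T; _∧_; if_then_else_)
open import Data.Bool.Properties using (∧-identityʳ; ∧-zeroʳ)
open import Data.Fin as Fin using (Fin; toℕ)
open import Data.Fin.Properties using (toℕ<n; toℕ-injective; any?)
open import Data.List using ([]; _∷_; length; filterᵇ; foldr; allFin)
open import Data.List.Base using () renaming (tabulate to tabulateL)
open import Data.List.Properties using (tabulate-cong)
open import Data.List.Membership.Propositional using (_∈_)
open import Data.List.Membership.Propositional.Properties using (∈-allFin)
open import Data.List.Relation.Unary.Any using (here; there)
open import Data.Nat.ListAction using (sum)
import Data.Integer as ℤ
import Data.Integer.Properties as ℤP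
open import Data.Product using (∃; _×_; _,_)
open import Data.Empty using (⊥; ⊥-elim)
open import Function using (id)
open import Relation.Binary.PropositionalEquality using (_≡_; _≢_; refl; subst; sym; trans; cong; cong₂; module ≡-Reasoning)
open import Relation.Nullary using (¬_; yes; no; _×-dec_)
open import Relation.Nullary.Reflects using (ofʸ; ofⁿ)

𝟙 : Bool → ℕ
𝟙 true  = 1
𝟙 false = 0

𝟙≤1 : ∀ b → 𝟙 b ≤ 1
𝟙≤1 true  = ≤-refl
𝟙≤1 false = z≤n

𝟙-T : ∀ {b} → T b → 𝟙 b ≡ 1
𝟙-T {true} _ = refl

𝟙[0<ᵇ]≤ : ∀ v → 𝟙 (0 <ᵇ v) ≤ v
𝟙[0<ᵇ]≤ zero    = z≤n
𝟙[0<ᵇ]≤ (suc _) = s≤s z≤n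

≤ᵇ≡<ᵇsuc : ∀ k j → (k ≤ᵇ j) ≡ (k <ᵇ suc j)
≤ᵇ≡<ᵇsuc zero    j = refl
≤ᵇ≡<ᵇsuc (suc k) j = refl

∑ : ∀ N → (Fin N → ℕ) → ℕ
∑ N f = sum (tabulateL f)

syntax ∑ N (λ k → e) = ∑[ k < N ] e

∑-cong : ∀ {N} {f g : Fin N → ℕ} → (∀ k → f k ≡ g k) → ∑ N f ≡ ∑ N g
∑-cong f≗g = cong sum (tabulate-cong f≗g)

∑-+ : ∀ {N} (f g : Fin N → ℕ) → ∑[ k < N ] (f k + g k) ≡ ∑ N f + ∑ N g
∑-+ {zero}  f g = refl
∑-+ {suc N} f g = trans (cong ((f Fin.zero + g Fin.zero) +_) (∑-+ (λ k → f (Fin.suc k)) (λ k → g (Fin.suc k))))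
                        (interchange (f Fin.zero) (g Fin.zero) _ _)

∑-mono-≤ : ∀ {N} {f g : Fin N → ℕ} → (∀ k → f k ≤ g k) → ∑ N f ≤ ∑ N g
∑-mono-≤ {zero}  f≤g = z≤n
∑-mono-≤ {suc N} f≤g = +-mono-≤ (f≤g Fin.zero) (∑-mono-≤ (λ k → f≤g (Fin.suc k)))

∑-mono-< : ∀ {N} {f g : Fin N → ℕ} → (∀ k → f k ≤ g k) → ∀ q → f q < g q → ∑ N f < ∑ N g
∑-mono-< f≤g Fin.zero    fq<gq = +-mono-<-≤ fq<gq (∑-mono-≤ (λ k → f≤g (Fin.suc k)))
∑-mono-< f≤g (Fin.suc q) fq<gq = +-mono-≤-< (f≤g Fin.zero) (∑-mono-< (λ k → f≤g (Fin.suc k)) q fq<gq)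

length-filterᵇ-tabulate : ∀ {A : Set} {N} (p : A → Bool) (f : Fin N → A) →
  length (filterᵇ p (tabulateL f)) ≡ ∑[ k < N ] 𝟙 (p (f k))
length-filterᵇ-tabulate {N = zero}  p f = refl
length-filterᵇ-tabulate {N = suc N} p f with p (f Fin.zero)
... | true  = cong suc (length-filterᵇ-tabulate p (λ k → f (Fin.suc k)))
... | false = length-filterᵇ-tabulate p (λ k → f (Fin.suc k))

∑-<ᵇ : ∀ N c → ∑[ k < N ] 𝟙 (toℕ k <ᵇ c) ≡ c ⊓ N
∑-<ᵇ zero    c       = sym (⊓-zeroʳ c)
∑-<ᵇ (suc N) zero    = ∑-<ᵇ N zero
∑-<ᵇ (suc N) (suc c) = cong suc (∑-<ᵇ N c)

∑-<ᵇ-suc : ∀ {N} (j : Fin N) → ∑[ k < N ] 𝟙 (toℕ k <ᵇ suc (toℕ j)) ≡ suc (toℕ j)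
∑-<ᵇ-suc {N} j = trans (∑-<ᵇ N (suc (toℕ j))) (m≤n⇒m⊓n≡m (toℕ<n j))

rank≡∑ : ∀ {N} (α : Comp N) i →
  rank α i ≡ ∑[ k < N ] (𝟙 (α i <ᵇ α k) + 𝟙 ((toℕ k ≤ᵇ toℕ i) ∧ (α k ≡ᵇ α i)))
rank≡∑ {N} α i = trans (cong₂ _+_ (length-filterᵇ-tabulate above id) (length-filterᵇ-tabulate tiedUpTo-i id))
                       (sym (∑-+ (λ k → 𝟙 (above k)) (λ k → 𝟙 (tiedUpTo-i k))))
  where
  above tiedUpTo-i : Fin N → Bool
  above k      = α i <ᵇ α k
  tiedUpTo-i k = (toℕ k ≤ᵇ toℕ i) ∧ (α k ≡ᵇ α i)

zeroRankSummand : ℕ → ℕ → ℕ → ℕ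
zeroRankSummand v k j = 𝟙 (0 <ᵇ v) + 𝟙 ((k ≤ᵇ j) ∧ (v ≡ᵇ 0))

rank-of-zero : ∀ {N} (α : Comp N) j → α j ≡ 0 → rank α j ≡ ∑[ k < N ] zeroRankSummand (α k) (toℕ k) (toℕ j)
rank-of-zero {N} α j αj≡0 =
  trans (rank≡∑ α j) (cong (λ v → ∑[ k < N ] (𝟙 (v <ᵇ α k) + 𝟙 ((toℕ k ≤ᵇ toℕ j) ∧ (α k ≡ᵇ v)))) αj≡0)

zeroRankSummand-≡ : ∀ v k j → (0 < v → k ≤ j) → zeroRankSummand v k j ≡ 𝟙 (k <ᵇ suc j)
zeroRankSummand-≡ zero    k j _   = cong 𝟙 (trans (∧-identityʳ (k ≤ᵇ j)) (≤ᵇ≡<ᵇsuc k j))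
zeroRankSummand-≡ (suc _) k j k≤j =
  trans (cong (λ b → suc (𝟙 b)) (∧-zeroʳ (k ≤ᵇ j))) (sym (𝟙-T (<⇒<ᵇ (s≤s (k≤j (s≤s z≤n))))))

zeroRankSummand-≥ : ∀ v k j → 𝟙 (k <ᵇ suc j) ≤ zeroRankSummand v k j
zeroRankSummand-≥ zero    k j = ≤-reflexive (sym (zeroRankSummand-≡ zero k j (λ ())))
zeroRankSummand-≥ (suc _) k j = ≤-trans (𝟙≤1 (k <ᵇ suc j)) (m≤m+n 1 _)

zeroRankSummand-> : ∀ v k j → 0 < v → j < k → 𝟙 (k <ᵇ suc j) < zeroRankSummand v k j
zeroRankSummand-> (suc _) k j _ j<k with k <ᵇ suc j | <ᵇ-reflects-< k (suc j)
... | false | _        = s≤s z≤n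
... | true  | ofʸ k≤j = ⊥-elim (<⇒≱ j<k (s≤s⁻¹ k≤j))

rank-zero-past-support : ∀ {N} (α : Comp N) j → α j ≡ 0 → (∀ k → 0 < α k → toℕ k ≤ toℕ j) →
  rank α j ≡ suc (toℕ j)
rank-zero-past-support {N} α j αj≡0 support≤j = begin
  rank α j                                               ≡⟨ rank-of-zero α j αj≡0 ⟩
  ∑[ k < N ] zeroRankSummand (α k) (toℕ k) (toℕ j)        ≡⟨ ∑-cong summand≡ ⟩
  ∑[ k < N ] 𝟙 (toℕ k <ᵇ suc (toℕ j))                     ≡⟨ ∑-<ᵇ-suc j ⟩
  suc (toℕ j)                                            ∎
  where
  open ≡-Reasoning
  summand≡ : ∀ k → zeroRankSummand (α k) (toℕ k) (toℕ j) ≡ 𝟙 (toℕ k <ᵇ suc (toℕ j))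
  summand≡ k = zeroRankSummand-≡ (α k) (toℕ k) (toℕ j) (support≤j k)

rank-zero-before-positive : ∀ {N} (β : Comp N) j q → β j ≡ 0 → 0 < β q → toℕ j < toℕ q →
  suc (toℕ j) < rank β j
rank-zero-before-positive {N} β j q βj≡0 0<βq j<q = begin-strict
  suc (toℕ j)                                            ≡⟨ ∑-<ᵇ-suc j ⟨
  ∑[ k < N ] 𝟙 (toℕ k <ᵇ suc (toℕ j))                     <⟨ ∑-mono-< summand≥ q summand>at-q ⟩
  ∑[ k < N ] zeroRankSummand (β k) (toℕ k) (toℕ j)        ≡⟨ rank-of-zero β j βj≡0 ⟨
  rank β j                                               ∎
  where
  open ≤-Reasoning
  summand≥ : ∀ k → 𝟙 (toℕ k <ᵇ suc (toℕ j)) ≤ zeroRankSummand (β k) (toℕ k) (toℕ j)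
  summand≥ k = zeroRankSummand-≥ (β k) (toℕ k) (toℕ j)
  summand>at-q : 𝟙 (toℕ q <ᵇ suc (toℕ j)) < zeroRankSummand (β q) (toℕ q) (toℕ j)
  summand>at-q = zeroRankSummand-> (β q) (toℕ q) (toℕ j) 0<βq j<q

foldr-⊔-≥ : ∀ {A : Set} (g : A → ℕ) {x xs} → x ∈ xs → g x ≤ foldr (λ y acc → g y ⊔ acc) 0 xs
foldr-⊔-≥ g (here refl)  = m≤m⊔n _ _
foldr-⊔-≥ g (there x∈xs) = m≤n⇒m≤o⊔n _ (foldr-⊔-≥ g x∈xs)

foldr-⊔-lub : ∀ {A : Set} (g : A → ℕ) {c} → (∀ x → g x ≤ c) → ∀ xs → foldr (λ y acc → g y ⊔ acc) 0 xs ≤ c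
foldr-⊔-lub g g≤c []       = z≤n
foldr-⊔-lub g g≤c (x ∷ xs) = ⊔-lub (g≤c x) (foldr-⊔-lub g g≤c xs)

len-> : ∀ {N} (α : Comp N) k → 0 < α k → toℕ k < len α
len-> α k 0<αk with α k | foldr-⊔-≥ (λ i → if 0 <ᵇ α i then suc (toℕ i) else 0) (∈-allFin k)
... | suc _ | k<len = k<len

len-lub : ∀ {N} (α : Comp N) c → (∀ k → 0 < α k → toℕ k < c) → len α ≤ c
len-lub {N} α c support<c = foldr-⊔-lub _ entry≤c (allFin N)
  where
  entry≤c : ∀ k → (if 0 <ᵇ α k then suc (toℕ k) else 0) ≤ c
  entry≤c k with α k | support<c k
  ... | zero  | _   = z≤n
  ... | suc _ | k<c = k<c (s≤s z≤n)

len≤⇒≡0 : ∀ {N} (α : Comp N) j → len α ≤ toℕ j → α j ≡ 0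
len≤⇒≡0 α j len≤j with α j in αj≡
... | zero  = refl
... | suc _ = ⊥-elim (<⇒≱ (len-> α j (subst (0 <_) (sym αj≡) (s≤s z≤n))) len≤j)

𝟙-below-cover : ∀ {v} k q a → (v ≡ 0 → a ≤ k → k ≤ q → ⊥) → 𝟙 (k <ᵇ suc q) ≤ 𝟙 (k <ᵇ a) + 𝟙 (0 <ᵇ v)
𝟙-below-cover {v} k q a gap with k <ᵇ suc q | <ᵇ-reflects-< k (suc q) | k <ᵇ a | <ᵇ-reflects-< k a | v
... | false | _         | _     | _        | _     = z≤n
... | true  | _         | true  | _        | _     = s≤s z≤n
... | true  | _         | false | _        | suc _ = s≤s z≤n
... | true  | ofʸ k<1+q | false | ofⁿ k≮a | zero  = ⊥-elim (gap refl (≮⇒≥ k≮a) (s≤s⁻¹ k<1+q))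

zero-in-gap : ∀ {N} (β : Comp N) a q → 0 < β q → a + size β ≤ toℕ q →
  ∃ λ j → a ≤ toℕ j × toℕ j < toℕ q × β j ≡ 0
zero-in-gap {N} β a q 0<βq a+|β|≤q with any? (λ j → a ≤? toℕ j ×-dec toℕ j <? toℕ q ×-dec β j ≟ 0)
... | yes gap = gap
... | no ¬gap = ⊥-elim (<⇒≱ q<a+|β| a+|β|≤q)
  where
  no-zero-up-to-q : ∀ k → β k ≡ 0 → a ≤ toℕ k → toℕ k ≤ toℕ q → ⊥
  no-zero-up-to-q k βk≡0 a≤k k≤q = ¬gap (k , a≤k , ≤∧≢⇒< k≤q k≢q , βk≡0)
    where
    k≢q : toℕ k ≢ toℕ q
    k≢q k≡q = <⇒≢ 0<βq (sym (trans (cong β (sym (toℕ-injective k≡q))) βk≡0))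

  q<a+|β| : toℕ q < a + size β
  q<a+|β| = begin-strict
    toℕ q                                             <⟨ n<1+n (toℕ q) ⟩
    suc (toℕ q)                                       ≡⟨ ∑-<ᵇ-suc q ⟨
    ∑[ k < N ] 𝟙 (toℕ k <ᵇ suc (toℕ q))               ≤⟨ ∑-mono-≤ (λ k → 𝟙-below-cover (toℕ k) (toℕ q) a (no-zero-up-to-q k)) ⟩
    ∑[ k < N ] (𝟙 (toℕ k <ᵇ a) + 𝟙 (0 <ᵇ β k))       ≡⟨ ∑-+ (λ k → 𝟙 (toℕ k <ᵇ a)) (λ k → 𝟙 (0 <ᵇ β k)) ⟩
    ∑[ k < N ] 𝟙 (toℕ k <ᵇ a) + ∑[ k < N ] 𝟙 (0 <ᵇ β k)
      ≤⟨ +-mono-≤ (≤-trans (≤-reflexive (∑-<ᵇ N a)) (m⊓n≤m a N)) (∑-mono-≤ (λ k → 𝟙[0<ᵇ]≤ (β k))) ⟩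
    a + size β                                        ∎
    where open ≤-Reasoning

⊳⇒size≡ : ∀ {N} {α β : Comp N} → α ⊳ β → size α ≡ size β
⊳⇒size≡ (byPlus |α|≡|β| _)   = |α|≡|β|
⊳⇒size≡ (bySame |α|≡|β| _ _) = |α|≡|β|

CriticalPair⇒rank≡ : ∀ {N n m} {α β : Comp N} → 1 ≤ n → CriticalPair n m α β →
  ∀ j → α j ≡ β j → rank β j ≡ rank α j
CriticalPair⇒rank≡ {n = suc n} {m} {α} {β} (s≤s z≤n) (_ , critical) j αj≡βj =
  ℤP.+-injective (ℤP.i-j≡0⇒i≡j _ _ (ℤP.*-cancelʳ-≡ _ ℤ.0ℤ (ℤ.+ suc n) (begin
    (ℤ.+ rank β j ℤ.- ℤ.+ rank α j) ℤ.* ℤ.+ suc n  ≡⟨ critical j ⟩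
    ℤ.+ m ℤ.* (ℤ.+ α j ℤ.- ℤ.+ β j)                ≡⟨ cong (λ b → ℤ.+ m ℤ.* (ℤ.+ α j ℤ.- ℤ.+ b)) αj≡βj ⟨
    ℤ.+ m ℤ.* (ℤ.+ α j ℤ.- ℤ.+ α j)                ≡⟨ cong (ℤ.+ m ℤ.*_) (ℤP.+-inverseʳ (ℤ.+ α j)) ⟩
    ℤ.+ m ℤ.* ℤ.0ℤ                                 ≡⟨ ℤP.*-zeroʳ (ℤ.+ m) ⟩
    ℤ.0ℤ                                           ∎)))
  where open ≡-Reasoning

mainTheorem3 : (m n N : ℕ) → 1 ≤ m → 1 ≤ n → (α β : Comp N) →
    CriticalPair n m α β → len β ≤ len α + size α
mainTheorem3 m n N _ 1≤n α β critical@(α⊳β , _) =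
  len-lub β (len α + size α) (λ q 0<βq → ≰⇒> (no-positive-from q 0<βq))
  where
  no-positive-from : ∀ q → 0 < β q → ¬ (len α + size α ≤ toℕ q)
  no-positive-from q 0<βq len+size≤q
    with j , len≤j , j<q , βj≡0 ← zero-in-gap β (len α) q 0<βq
                                    (subst (λ s → len α + s ≤ toℕ q) (⊳⇒size≡ α⊳β) len+size≤q)
    = let αj≡0      = len≤⇒≡0 α j len≤j
          support≤j = λ k 0<αk → <⇒≤ (<-≤-trans (len-> α k 0<αk) len≤j)
      in <⇒≢ (rank-zero-before-positive β j q βj≡0 0<βq j<q) (begin
           suc (toℕ j)  ≡⟨ rank-zero-past-support α j αj≡0 support≤j ⟨
           rank α j     ≡⟨ CriticalPair⇒rank≡ {m = m} 1≤n critical j (trans αj≡0 (sym βj≡0)) ⟨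
           rank β j     ∎)
    where open ≡-Reasoning
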